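{- For every even integer $n\ge 8$, the total domination number of the $3$-regular Kn\"odel graph $W_{3,n}$ is $$\gamma_t(W_{3,n})=4\left\lceil \frac{n}{10}\right\rceil-\begin{cases}0 & \text{if } n\equiv 0,6,8 \pmod{10},\\ 2 & \text{if } n\equiv 2,4 \pmod{10}.\end{cases}$$
   Context: For an even integer $n\ge 2$ and an integer $1\le \Delta\le\lfloor\log_2 n\rfloor$, the Kn\"odel graph $W_{\Delta,n}$ is the bipartite graph with vertex set $\{(i,j): i\in\{1,2\},\ 0\le j\le n/2-1\}$, where for every $j$ with $0\le j\le n/2-1$ the vertex $(1,j)$ is adjacent to the vertices $(2,(j+2^k-1)\bmod (n/2))$ for $k=0,1,\dots,\Delta-1$, and there are no other edges; it is $\Delta$-regular of order $n$. A set $D$ of vertices of a graph $G$ is a total dominating set if every vertex of $G$ (including those in $D$) is adjacent to some vertex of $D$; the total domination number $\gamma_t(G)$ is the minimum cardinality of a total dominating set of $G$. -}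

module Defs where

open import Data.Nat using (ℕ; zero; suc; _+_; _*_; _∸_; _^_; _≤_; _<_; NonZero; _/_; _%_)
open import Data.Fin using (Fin; toℕ)
open import Data.Product using (_×_; _,_; ∃; Σ)
open import Data.Sum using (_⊎_)
open import Data.List using (List; length)
open import Data.List.Membership.Propositional using (_∈_)
open import Data.List.Relation.Unary.Unique.Propositional using (Unique)
open import Relation.Binary.PropositionalEquality using (_≡_)

finNonZero : {h : ℕ} → Fin h → NonZero h
finNonZero {suc h} _ = _

-- Vertices of the Knödel graph of order n: (i , j) with i ∈ {1,2}
-- (encoded as Fin 2: 0 ↦ 1, 1 ↦ 2) and 0 ≤ j ≤ n/2 - 1.
KVertex : ℕ → Set
KVertex n = Fin 2 × Fin (n / 2)

KEdge : (Δ n : ℕ) → Fin (n / 2) → Fin (n / 2) → Set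
KEdge Δ n j j' =
  ∃ λ k → k < Δ × toℕ j' ≡ _%_ (toℕ j + 2 ^ k ∸ 1) (n / 2) {{finNonZero j}}

KAdj : (Δ n : ℕ) → KVertex n → KVertex n → Set
KAdj Δ n (i , j) (i' , j') =
  (toℕ i ≡ 0 × toℕ i' ≡ 1 × KEdge Δ n j j')
  ⊎ (toℕ i ≡ 1 × toℕ i' ≡ 0 × KEdge Δ n j' j)

IsTotalDominating : (Δ n : ℕ) → List (KVertex n) → Set
IsTotalDominating Δ n D = ∀ v → ∃ λ u → u ∈ D × KAdj Δ n v u

TotalDominationNumber : (Δ n : ℕ) → ℕ → Set
TotalDominationNumber Δ n t =
  (∃ λ D → Unique D × IsTotalDominating Δ n D × length D ≡ t)
  × (∀ D → Unique D → IsTotalDominating Δ n D → t ≤ length D)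

correction : ℕ → ℕ
correction n with n % 10
... | 2 = 2
... | 4 = 2
... | _ = 0

ceil10 : ℕ → ℕ
ceil10 n = (n + 9) / 10

module Submission where

-- Put m = n/2.  The vertex (1,j) is joined to (2,j+d) for the offsets d ∈ {0,1,3} (indices
-- mod m), so a total dominating set D consists of a left index set A and a right index set B
-- such that every residue y has an element of A in {y, y−1, y−3} (to dominate (2,y)) and an
-- element of B in {y, y+1, y+3} (to dominate (1,y)).
--
-- A discharging argument (amortise, window-density) with a potential on
-- windows of three consecutive residues shows that an m-periodic 0/1 sequence obeying either
-- local rule (RuleA, RuleB) has at least 2m/5 ones per period; reading the index sets of D
-- as such sequences (left-rule, right-rule, density-bound) gives |D| ≥ 2⌈2m/5⌉ (lower-bound).  An explicit set S ⊆ {0,…,m−1} of size ⌈2m/5⌉ with {0,…,m−1} ⊆ S + {0,1,3}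
-- (cover) yields the total dominating set A = S, B = (m−1) − S (fromCover).
-- Hence γ_t(W_{3,n}) = 2⌈n/5⌉ (W3.γt), and the identity 4⌈n/10⌉ = c(n) + 2⌈n/5⌉ for even n
-- (knodel-formula) turns this into the stated formula.

open import Defs
open import Data.Nat using (ℕ; _*_; _∸_; _≤_; _%_)
open import Relation.Binary.PropositionalEquality using (_≡_)

open import Data.Bool using (Bool; true; false; T; _∨_)
open import Data.Bool.Properties using (T-∨)
open import Data.Empty using (⊥-elim)
open import Data.Fin using (Fin; toℕ; zero; suc)
open import Data.Fin.Properties using (toℕ<n; toℕ-fromℕ<)
open import Data.List using (List; []; _∷_; length; map; _++_)
open import Data.List.Membership.Propositional using (_∈_)
open import Data.List.Membership.Propositional.Properties using (∈-map⁺; ∈-map⁻; ∈-++⁺ˡ; ∈-++⁺ʳ)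
open import Data.List.Properties using (length-map; length-++)
open import Data.List.Relation.Unary.All using (All; []; _∷_)
import Data.List.Relation.Unary.All as All
open import Data.List.Relation.Unary.All.Properties using (map⁺; gmap⁺)
open import Data.List.Relation.Unary.AllPairs using ([]; _∷_)
open import Data.List.Relation.Unary.Any using (here; there)
open import Data.List.Relation.Unary.Unique.Propositional using (Unique)
import Data.List.Relation.Unary.Unique.Propositional.Properties as Unique
open import Data.Nat using (zero; suc; _+_; _^_; _<_; _≡ᵇ_; z≤n; s≤s; s≤s⁻¹; z<s; s<s; NonZero; >-nonZero; _/_; _<?_; _≟_; pred)
open import Data.Nat.DivMod
open import Data.Nat.Divisibility using (divides; m%n≡0⇒n∣m)
open import Data.Nat.Properties
open import Data.Nat.Tactic.RingSolver using (solve-∀)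
open import Algebra.Properties.CommutativeSemigroup +-commutativeSemigroup using (x∙yz≈y∙xz; interchange)
open import Data.Product using (_×_; _,_; ∃)
open import Data.Sum using (_⊎_; inj₁; inj₂)
open import Function using (_∘_; Equivalence)
open import Relation.Binary.PropositionalEquality using (refl; sym; trans; cong; cong₂; subst; _≢_; module ≡-Reasoning)
open import Relation.Nullary using (¬_; yes; no)

-- Sums over initial segments, counting, and amortisation

sumBelow : (ℕ → ℕ) → ℕ → ℕ
sumBelow f zero    = 0
sumBelow f (suc J) = sumBelow f J + f J

sumBelow-cong : ∀ {f g} J → (∀ x → x < J → f x ≡ g x) → sumBelow f J ≡ sumBelow g J
sumBelow-cong zero    _  = refl
sumBelow-cong (suc J) eq =
  cong₂ _+_ (sumBelow-cong J (λ x x<J → eq x (m<n⇒m<1+n x<J))) (eq J ≤-refl)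

sumBelow-mono : ∀ {f g} J → (∀ x → f x ≤ g x) → sumBelow f J ≤ sumBelow g J
sumBelow-mono zero    _  = z≤n
sumBelow-mono (suc J) le = +-mono-≤ (sumBelow-mono J le) (le J)

sumBelow-+ : ∀ f g J → sumBelow (λ x → f x + g x) J ≡ sumBelow f J + sumBelow g J
sumBelow-+ f g zero    = refl
sumBelow-+ f g (suc J) = trans (cong (_+ (f J + g J)) (sumBelow-+ f g J))
                               (interchange (sumBelow f J) (sumBelow g J) (f J) (g J))

sumBelow-scale : ∀ k f J → sumBelow (λ x → k * f x) J ≡ k * sumBelow f J
sumBelow-scale k f zero    = sym (*-zeroʳ k)
sumBelow-scale k f (suc J) =
  trans (cong (_+ k * f J) (sumBelow-scale k f J)) (sym (*-distribˡ-+ k (sumBelow f J) (f J)))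

amortise : ∀ c (w Φ : ℕ → ℕ) → (∀ J → c + Φ J ≤ w J + Φ (suc J)) →
           ∀ J → J * c + Φ 0 ≤ sumBelow w J + Φ J
amortise c w Φ step zero    = ≤-refl
amortise c w Φ step (suc J) = begin
  (c + J * c) + Φ 0                ≡⟨ +-assoc c (J * c) (Φ 0) ⟩
  c + (J * c + Φ 0)                ≤⟨ +-monoʳ-≤ c (amortise c w Φ step J) ⟩
  c + (sumBelow w J + Φ J)         ≡⟨ x∙yz≈y∙xz c (sumBelow w J) (Φ J) ⟩
  sumBelow w J + (c + Φ J)         ≤⟨ +-monoʳ-≤ (sumBelow w J) (step J) ⟩
  sumBelow w J + (w J + Φ (suc J)) ≡⟨ +-assoc (sumBelow w J) (w J) (Φ (suc J)) ⟨
  sumBelow w J + w J + Φ (suc J)   ∎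
  where open ≤-Reasoning

amortise-cyclic : ∀ c (w Φ : ℕ → ℕ) → (∀ J → c + Φ J ≤ w J + Φ (suc J)) →
                  ∀ m → Φ m ≡ Φ 0 → m * c ≤ sumBelow w m
amortise-cyclic c w Φ step m back = +-cancelʳ-≤ (Φ 0) (m * c) (sumBelow w m)
  (subst (λ z → m * c + Φ 0 ≤ sumBelow w m + z) back (amortise c w Φ step m))

indicator : Bool → ℕ
indicator true  = 1
indicator false = 0

indicator≤1 : ∀ b → indicator b ≤ 1
indicator≤1 true  = ≤-refl
indicator≤1 false = z≤n

indicator-false : ∀ {b} → ¬ T b → indicator b ≡ 0
indicator-false {true}  ¬t = ⊥-elim (¬t _)
indicator-false {false} _  = refl

count : (ℕ → Bool) → ℕ → ℕ
count a = sumBelow (indicator ∘ a)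

count-∨ : ∀ a b J → count (λ x → a x ∨ b x) J ≤ count a J + count b J
count-∨ a b J = begin
  count (λ x → a x ∨ b x) J                          ≤⟨ sumBelow-mono J (λ x → indicator-∨ (a x) (b x)) ⟩
  sumBelow (λ x → indicator (a x) + indicator (b x)) J ≡⟨ sumBelow-+ (indicator ∘ a) (indicator ∘ b) J ⟩
  count a J + count b J                              ∎
  where
  open ≤-Reasoning
  indicator-∨ : ∀ p q → indicator (p ∨ q) ≤ indicator p + indicator q
  indicator-∨ true  q = s≤s z≤n
  indicator-∨ false q = ≤-refl

count-none : ∀ a J → (∀ x → x < J → ¬ T (a x)) → count a J ≡ 0
count-none a zero    _   = refl
count-none a (suc J) off =
  cong₂ _+_ (count-none a J (λ x x<J → off x (m<n⇒m<1+n x<J))) (indicator-false (off J ≤-refl))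

count-≡ᵇ : ∀ y J → count (_≡ᵇ y) J ≤ 1
count-≡ᵇ y zero    = z≤n
count-≡ᵇ y (suc J) with J ≟ y
... | yes refl = subst (_≤ 1) (cong (_+ indicator (J ≡ᵇ J)) (sym (count-none (_≡ᵇ J) J below)))
                       (indicator≤1 (J ≡ᵇ J))
  where
  below : ∀ x → x < J → ¬ T (x ≡ᵇ J)
  below x x<J t = <-irrefl (≡ᵇ⇒≡ x J t) x<J
... | no J≢y = subst (_≤ 1) (sym (trans (cong (count (_≡ᵇ y) J +_) (indicator-false (J≢y ∘ ≡ᵇ⇒≡ J y)))
                                        (+-identityʳ (count (_≡ᵇ y) J))))
                     (count-≡ᵇ y J)

T-∨ˡ : ∀ {p q} → T p → T (p ∨ q)
T-∨ˡ = Equivalence.from T-∨ ∘ inj₁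

T-∨ʳ : ∀ {p q} → T q → T (p ∨ q)
T-∨ʳ = Equivalence.from T-∨ ∘ inj₂

mem : ℕ → List ℕ → Bool
mem x []      = false
mem x (y ∷ L) = (x ≡ᵇ y) ∨ mem x L

mem-complete : ∀ {x L} → x ∈ L → T (mem x L)
mem-complete {x} (here refl) = T-∨ˡ (≡⇒≡ᵇ x x refl)
mem-complete     (there x∈L) = T-∨ʳ (mem-complete x∈L)

count-mem : ∀ J L → count (λ x → mem x L) J ≤ length L
count-mem J []      = ≤-reflexive (count-none (λ _ → false) J (λ _ _ ()))
count-mem J (y ∷ L) = begin
  count (λ x → (x ≡ᵇ y) ∨ mem x L) J        ≤⟨ count-∨ (_≡ᵇ y) (λ x → mem x L) J ⟩
  count (_≡ᵇ y) J + count (λ x → mem x L) J ≤⟨ +-mono-≤ (count-≡ᵇ y J) (count-mem J L) ⟩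
  1 + length L                              ∎
  where open ≤-Reasoning

-- Density of sequences obeying a local rule

Obeys : (Bool → Bool → Bool → Bool → Set) → (ℕ → Bool) → Set
Obeys W a = ∀ y → W (a y) (a (1 + y)) (a (2 + y)) (a (3 + y))

window-density :
  (W : Bool → Bool → Bool → Bool → Set) (φ : Bool → Bool → Bool → ℕ) (c k : ℕ) →
  (∀ b₀ b₁ b₂ b₃ → W b₀ b₁ b₂ b₃ → c + φ b₀ b₁ b₂ ≤ k * indicator b₀ + φ b₁ b₂ b₃) →
  ∀ m (a : ℕ → Bool) → (∀ y → a (y + m) ≡ a y) → Obeys W a →
  m * c ≤ k * count a m
window-density W φ c k step m a periodic rule = begin
  m * c                                 ≤⟨ amortise-cyclic c w Φ payment m back ⟩
  sumBelow (λ J → k * indicator (a J)) m ≡⟨ sumBelow-scale k (indicator ∘ a) m ⟩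
  k * count a m                         ∎
  where
  open ≤-Reasoning
  w Φ : ℕ → ℕ
  w J = k * indicator (a J)
  Φ J = φ (a J) (a (1 + J)) (a (2 + J))
  payment : ∀ J → c + Φ J ≤ w J + Φ (suc J)
  payment J = step (a J) (a (1 + J)) (a (2 + J)) (a (3 + J)) (rule J)
  back : Φ m ≡ Φ 0
  back = trans (cong (λ b → φ b (a (1 + m)) (a (2 + m))) (periodic 0))
               (cong₂ (φ (a 0)) (periodic 1) (periodic 2))

RuleA : Bool → Bool → Bool → Bool → Set
RuleA b₀ b₁ b₂ b₃ = T b₀ ⊎ T b₂ ⊎ T b₃

RuleB : Bool → Bool → Bool → Bool → Set
RuleB b₀ b₁ b₂ b₃ = T b₀ ⊎ T b₁ ⊎ T b₃

-- Potentials certifying density 2/5 for the two rules.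
potentialA : Bool → Bool → Bool → ℕ
potentialA false false false = 0
potentialA false false true  = 2
potentialA false true  false = 4
potentialA false true  true  = 4
potentialA true  false false = 3
potentialA true  false true  = 6
potentialA true  true  false = 6
potentialA true  true  true  = 6

potentialB : Bool → Bool → Bool → ℕ
potentialB false false false = 0
potentialB false false true  = 2
potentialB false true  false = 0
potentialB false true  true  = 4
potentialB true  false false = 3
potentialB true  false true  = 3
potentialB true  true  false = 6
potentialB true  true  true  = 6

-- The discharging inequalities on all 16 windows, each decided by evaluation; the windows
-- excluded by a rule are exactly those where the inequality fails.
potentialA-step : ∀ b₀ b₁ b₂ b₃ → RuleA b₀ b₁ b₂ b₃ →
                  2 + potentialA b₀ b₁ b₂ ≤ 5 * indicator b₀ + potentialA b₁ b₂ b₃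
potentialA-step true  true  true  true  _ = ≤ᵇ⇒≤ _ _ _
potentialA-step true  true  true  false _ = ≤ᵇ⇒≤ _ _ _
potentialA-step true  true  false true  _ = ≤ᵇ⇒≤ _ _ _
potentialA-step true  true  false false _ = ≤ᵇ⇒≤ _ _ _
potentialA-step true  false true  true  _ = ≤ᵇ⇒≤ _ _ _
potentialA-step true  false true  false _ = ≤ᵇ⇒≤ _ _ _
potentialA-step true  false false true  _ = ≤ᵇ⇒≤ _ _ _
potentialA-step true  false false false _ = ≤ᵇ⇒≤ _ _ _
potentialA-step false true  true  true  _ = ≤ᵇ⇒≤ _ _ _
potentialA-step false true  true  false _ = ≤ᵇ⇒≤ _ _ _
potentialA-step false true  false true  _ = ≤ᵇ⇒≤ _ _ _
potentialA-step false true  false false (inj₁ ())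
potentialA-step false true  false false (inj₂ (inj₁ ()))
potentialA-step false true  false false (inj₂ (inj₂ ()))
potentialA-step false false true  true  _ = ≤ᵇ⇒≤ _ _ _
potentialA-step false false true  false _ = ≤ᵇ⇒≤ _ _ _
potentialA-step false false false true  _ = ≤ᵇ⇒≤ _ _ _
potentialA-step false false false false (inj₁ ())
potentialA-step false false false false (inj₂ (inj₁ ()))
potentialA-step false false false false (inj₂ (inj₂ ()))

potentialB-step : ∀ b₀ b₁ b₂ b₃ → RuleB b₀ b₁ b₂ b₃ →
                  2 + potentialB b₀ b₁ b₂ ≤ 5 * indicator b₀ + potentialB b₁ b₂ b₃
potentialB-step true  true  true  true  _ = ≤ᵇ⇒≤ _ _ _
potentialB-step true  true  true  false _ = ≤ᵇ⇒≤ _ _ _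
potentialB-step true  true  false true  _ = ≤ᵇ⇒≤ _ _ _
potentialB-step true  true  false false _ = ≤ᵇ⇒≤ _ _ _
potentialB-step true  false true  true  _ = ≤ᵇ⇒≤ _ _ _
potentialB-step true  false true  false _ = ≤ᵇ⇒≤ _ _ _
potentialB-step true  false false true  _ = ≤ᵇ⇒≤ _ _ _
potentialB-step true  false false false _ = ≤ᵇ⇒≤ _ _ _
potentialB-step false true  true  true  _ = ≤ᵇ⇒≤ _ _ _
potentialB-step false true  true  false _ = ≤ᵇ⇒≤ _ _ _
potentialB-step false true  false true  _ = ≤ᵇ⇒≤ _ _ _
potentialB-step false true  false false _ = ≤ᵇ⇒≤ _ _ _
potentialB-step false false true  true  _ = ≤ᵇ⇒≤ _ _ _
potentialB-step false false true  false (inj₁ ())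
potentialB-step false false true  false (inj₂ (inj₁ ()))
potentialB-step false false true  false (inj₂ (inj₂ ()))
potentialB-step false false false true  _ = ≤ᵇ⇒≤ _ _ _
potentialB-step false false false false (inj₁ ())
potentialB-step false false false false (inj₂ (inj₁ ()))
potentialB-step false false false false (inj₂ (inj₂ ()))

⌈_/5⌉ : ℕ → ℕ
⌈ a /5⌉ = (a + 4) / 5

ceil-least : ∀ k {a s} → a ≤ suc k * s → (a + k) / suc k ≤ s
ceil-least k {a} {s} a≤ = s≤s⁻¹ (m<n*o⇒m/o<n (begin-strict
  a + k             ≤⟨ +-monoˡ-≤ k a≤ ⟩
  suc k * s + k     <⟨ +-monoʳ-< (suc k * s) (n<1+n k) ⟩
  suc k * s + suc k ≡⟨ +-comm (suc k * s) (suc k) ⟩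
  suc k + suc k * s ≡⟨ cong (suc k +_) (*-comm (suc k) s) ⟩
  suc s * suc k     ∎))
  where open ≤-Reasoning

%-cancelʳ-+ : ∀ m .{{_ : NonZero m}} a b d → (a + d) % m ≡ (b + d) % m → a % m ≡ b % m
%-cancelʳ-+ (suc m') a b d eq = begin
  a % m                              ≡⟨ [m+kn]%n≡m%n a d m ⟨
  (a + d * m) % m                    ≡⟨ cong (_% m) (shift a) ⟩
  ((a + d) + d * m') % m             ≡⟨ %-distribˡ-+ (a + d) (d * m') m ⟩
  ((a + d) % m + (d * m') % m) % m   ≡⟨ cong (λ z → (z + (d * m') % m) % m) eq ⟩
  ((b + d) % m + (d * m') % m) % m   ≡⟨ %-distribˡ-+ (b + d) (d * m') m ⟨
  ((b + d) + d * m') % m             ≡⟨ cong (_% m) (shift b) ⟨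
  (b + d * m) % m                    ≡⟨ [m+kn]%n≡m%n b d m ⟩
  b % m                              ∎
  where
  open ≡-Reasoning
  m = suc m'
  shift : ∀ x → x + d * m ≡ (x + d) + d * m'
  shift x = trans (cong (x +_) (*-suc d m')) (sym (+-assoc x d (d * m')))

%-absorbˡ-+ : ∀ m .{{_ : NonZero m}} a b → (a % m + b) % m ≡ (a + b) % m
%-absorbˡ-+ m a b = begin
  (a % m + b) % m           ≡⟨ %-distribˡ-+ (a % m) b m ⟩
  (a % m % m + b % m) % m   ≡⟨ cong (λ z → (z + b % m) % m) (m%n%n≡m%n a m) ⟩
  (a % m + b % m) % m       ≡⟨ %-distribˡ-+ a b m ⟨
  (a + b) % m               ∎
  where open ≡-Reasoning

-- Offsets and covers

-- The generator offsets 2^k − 1 (k < 3) of W_{3,n}.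
data Offset : ℕ → Set where
  offset0 : Offset 0
  offset1 : Offset 1
  offset3 : Offset 3

exponent⇒offset : ∀ {k} → k < 3 → Offset (2 ^ k ∸ 1)
exponent⇒offset {0} _ = offset0
exponent⇒offset {1} _ = offset1
exponent⇒offset {2} _ = offset3
exponent⇒offset {suc (suc (suc _))} (s≤s (s≤s (s≤s ())))

offset⇒exponent : ∀ {d} → Offset d → ∃ λ k → k < 3 × 2 ^ k ∸ 1 ≡ d
offset⇒exponent offset0 = 0 , s≤s z≤n , refl
offset⇒exponent offset1 = 1 , s≤s (s≤s z≤n) , refl
offset⇒exponent offset3 = 2 , s≤s (s≤s (s≤s z≤n)) , refl

Covered : List ℕ → ℕ → Set
Covered S x = ∃ λ s → s ∈ S × ∃ λ d → Offset d × x ≡ s + d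

pair-covers : ∀ L {x} → x < 5 → Covered (0 ∷ 1 ∷ L) x
pair-covers L {0} _ = 0 , here refl , 0 , offset0 , refl
pair-covers L {1} _ = 1 , there (here refl) , 0 , offset0 , refl
pair-covers L {2} _ = 1 , there (here refl) , 1 , offset1 , refl
pair-covers L {3} _ = 0 , here refl , 3 , offset3 , refl
pair-covers L {4} _ = 1 , there (here refl) , 3 , offset3 , refl
pair-covers L {suc (suc (suc (suc (suc _))))} (s≤s (s≤s (s≤s (s≤s (s≤s ())))))

-- A cover of {0, …, m−1} by translates s + {0,1,3} with s < m, of optimal size ⌈2m/5⌉:
-- the pattern {0, 1} repeated with period 5, suitably truncated.
cover : ℕ → List ℕ
cover 0 = []
cover 1 = 0 ∷ []
cover 2 = 0 ∷ []
cover 3 = 0 ∷ 1 ∷ []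
cover 4 = 0 ∷ 1 ∷ []
cover (suc (suc (suc (suc (suc m))))) = 0 ∷ 1 ∷ map (5 +_) (cover m)

cover-covers : ∀ m {x} → x < m → Covered (cover m) x
cover-covers 1 {0} _ = 0 , here refl , 0 , offset0 , refl
cover-covers 1 {suc _} (s≤s ())
cover-covers 2 {0} _ = 0 , here refl , 0 , offset0 , refl
cover-covers 2 {1} _ = 0 , here refl , 1 , offset1 , refl
cover-covers 2 {suc (suc _)} (s≤s (s≤s ()))
cover-covers 3 x<3 = pair-covers [] (≤-trans x<3 (≤ᵇ⇒≤ 3 5 _))
cover-covers 4 x<4 = pair-covers [] (m<n⇒m<1+n x<4)
cover-covers (suc (suc (suc (suc (suc m))))) {x} x<5+m with x <? 5
... | yes x<5 = pair-covers _ x<5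
... | no  x≮5 = subst (Covered _) (m+[n∸m]≡n 5≤x) (shifted (cover-covers m x∸5<m))
  where
  5≤x = ≮⇒≥ x≮5
  x∸5<m : x ∸ 5 < m
  x∸5<m = +-cancelˡ-< 5 (x ∸ 5) m (subst (_< 5 + m) (sym (m+[n∸m]≡n 5≤x)) x<5+m)
  shifted : ∀ {y} → Covered (cover m) y → Covered (cover (5 + m)) (5 + y)
  shifted (s , s∈ , d , off , refl) = 5 + s , there (there (∈-map⁺ (5 +_) s∈)) , d , off , refl

cover-length : ∀ m → length (cover m) ≡ ⌈ m * 2 /5⌉
cover-length 0 = refl
cover-length 1 = refl
cover-length 2 = refl
cover-length 3 = refl
cover-length 4 = refl
cover-length (suc (suc (suc (suc (suc m))))) = begin
  2 + length (map (5 +_) (cover m)) ≡⟨ cong (2 +_) (trans (length-map (5 +_) (cover m)) (cover-length m)) ⟩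
  2 + ⌈ m * 2 /5⌉                   ≡⟨ +-distrib-/-∣ˡ (m * 2 + 4) {5} (divides 2 refl) ⟨
  ⌈ (5 + m) * 2 /5⌉                 ∎
  where open ≡-Reasoning

cover-bound : ∀ m → All (_< m) (cover m)
cover-bound 0 = []
cover-bound 1 = z<s ∷ []
cover-bound 2 = z<s ∷ []
cover-bound 3 = z<s ∷ s<s z<s ∷ []
cover-bound 4 = z<s ∷ s<s z<s ∷ []
cover-bound (suc (suc (suc (suc (suc m))))) = z<s ∷ s<s z<s ∷ gmap⁺ (+-monoʳ-< 5) (cover-bound m)

cover-unique : ∀ m → Unique (cover m)
cover-unique 0 = []
cover-unique 1 = [] ∷ []
cover-unique 2 = [] ∷ []
cover-unique 3 = ((λ ()) ∷ []) ∷ [] ∷ []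
cover-unique 4 = ((λ ()) ∷ []) ∷ [] ∷ []
cover-unique (suc (suc (suc (suc (suc m))))) =
  ((λ ()) ∷ below5 z<s) ∷ below5 (s<s z<s) ∷ Unique.map⁺ (+-cancelˡ-≡ 5 _ _) (cover-unique m)
  where
  below5 : ∀ {x} → x < 5 → All (x ≢_) (map (5 +_) (cover m))
  below5 x<5 = map⁺ (All.universal (λ s x≡5+s → <-irrefl x≡5+s (≤-trans x<5 (m≤m+n 5 s))) (cover m))

unique-map : ∀ {A B : Set} {P : A → Set} (f : A → B) →
             (∀ {x y} → P x → P y → f x ≡ f y → x ≡ y) →
             ∀ {L} → All P L → Unique L → Unique (map f L)
unique-map f inj []        []          = []
unique-map {P = P} f inj (px ∷ pL) (x∉L ∷ uL) = fresh pL x∉L ∷ unique-map f inj pL uL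
  where
  fresh : ∀ {L} → All P L → All (_ ≢_) L → All (f _ ≢_) (map f L)
  fresh []          []          = []
  fresh (py ∷ pL') (x≢y ∷ x∉L') = (x≢y ∘ inj px py) ∷ fresh pL' x∉L'

∸-reflect : ∀ {M x s d} → x ≤ M → M ∸ x ≡ s + d → M ∸ s ≡ x + d
∸-reflect {M} {x} {s} {d} x≤M eq = begin
  M ∸ s           ≡⟨ cong (_∸ s) (m∸n+n≡m x≤M) ⟨
  M ∸ x + x ∸ s   ≡⟨ cong (λ z → z + x ∸ s) eq ⟩
  s + d + x ∸ s   ≡⟨ cong (_∸ s) (+-assoc s d x) ⟩
  s + (d + x) ∸ s ≡⟨ m+n∸m≡n s (d + x) ⟩
  d + x           ≡⟨ +-comm d x ⟩
  x + d           ∎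
  where open ≡-Reasoning

leftIndices : ∀ {h} → List (Fin 2 × Fin h) → List ℕ
leftIndices []                = []
leftIndices ((zero  , j) ∷ D) = toℕ j ∷ leftIndices D
leftIndices ((suc _ , _) ∷ D) = leftIndices D

rightIndices : ∀ {h} → List (Fin 2 × Fin h) → List ℕ
rightIndices []                = []
rightIndices ((zero  , _) ∷ D) = rightIndices D
rightIndices ((suc _ , j) ∷ D) = toℕ j ∷ rightIndices D

length-indices : ∀ {h} (D : List (Fin 2 × Fin h)) →
                 length (leftIndices D) + length (rightIndices D) ≡ length D
length-indices []                = refl
length-indices ((zero  , _) ∷ D) = cong suc (length-indices D)
length-indices ((suc _ , _) ∷ D) = trans (+-suc _ _) (cong suc (length-indices D))

∈-leftIndices : ∀ {h} {D : List (Fin 2 × Fin h)} {j} → (zero , j) ∈ D → toℕ j ∈ leftIndices D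
∈-leftIndices {D = (zero  , _) ∷ _} (here refl) = here refl
∈-leftIndices {D = (zero  , _) ∷ _} (there p)   = there (∈-leftIndices p)
∈-leftIndices {D = (suc _ , _) ∷ _} (there p)   = ∈-leftIndices p

∈-rightIndices : ∀ {h} {D : List (Fin 2 × Fin h)} {i j} → (suc i , j) ∈ D → toℕ j ∈ rightIndices D
∈-rightIndices {D = (suc _ , _) ∷ _} (here refl) = here refl
∈-rightIndices {D = (suc _ , _) ∷ _} (there p)   = there (∈-rightIndices p)
∈-rightIndices {D = (zero  , _) ∷ _} (there p)   = ∈-rightIndices p

module W3 (n : ℕ) {{_ : NonZero (n / 2)}} where

  m : ℕ
  m = n / 2

  toℕ-mod : ∀ {x} → x < m → toℕ (x mod m) ≡ x
  toℕ-mod x<m = trans (toℕ-fromℕ< _) (m<n⇒m%n≡m x<m)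

  Step : Fin m → Fin m → Set
  Step j j' = ∃ λ d → Offset d × toℕ j' ≡ (toℕ j + d) % m

  edge⇒step : ∀ {j j'} → KEdge 3 n j j' → Step j j'
  edge⇒step {j} (k , k<3 , eq) =
    2 ^ k ∸ 1 , exponent⇒offset k<3 , trans eq (cong (_% m) (+-∸-assoc (toℕ j) (m^n>0 2 k)))

  step⇒edge : ∀ {j j'} → Step j j' → KEdge 3 n j j'
  step⇒edge {j} (d , off , eq) with offset⇒exponent off
  ... | k , k<3 , refl = k , k<3 , trans eq (cong (_% m) (sym (+-∸-assoc (toℕ j) (m^n>0 2 k))))

  occupied : List ℕ → ℕ → Bool
  occupied L y = mem (y % m) L

  occupied-periodic : ∀ L y → occupied L (y + m) ≡ occupied L y
  occupied-periodic L y = cong (λ z → mem z L) ([m+n]%n≡m%n y m)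

  occupied-by : ∀ {L} (j : Fin m) y → toℕ j ∈ L → y % m ≡ toℕ j → T (occupied L y)
  occupied-by {L} j y j∈L eq = mem-complete (subst (_∈ L) (sym eq) j∈L)

  count-occupied : ∀ L → count (occupied L) m ≤ length L
  count-occupied L = ≤-trans (≤-reflexive (sumBelow-cong m reduce)) (count-mem m L)
    where
    reduce : ∀ y → y < m → indicator (occupied L y) ≡ indicator (mem y L)
    reduce y y<m = cong (λ z → indicator (mem z L)) (m<n⇒m%n≡m y<m)

  density-bound : ∀ {W φ} → (∀ b₀ b₁ b₂ b₃ → W b₀ b₁ b₂ b₃ → 2 + φ b₀ b₁ b₂ ≤ 5 * indicator b₀ + φ b₁ b₂ b₃) →
                  ∀ L → Obeys W (occupied L) → ⌈ m * 2 /5⌉ ≤ length L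
  density-bound {W} {φ} step L obeys = ceil-least 4 (begin
    m * 2                   ≤⟨ window-density W φ 2 5 step m (occupied L) (occupied-periodic L) obeys ⟩
    5 * count (occupied L) m ≤⟨ *-monoʳ-≤ 5 (count-occupied L) ⟩
    5 * length L            ∎)
    where open ≤-Reasoning

  -- Each right vertex (2, 3+y) has a left neighbour in D among (1,3+y), (1,2+y), (1,y).
  left-rule : ∀ D → IsTotalDominating 3 n D → Obeys RuleA (occupied (leftIndices D))
  left-rule D dom y with dom (suc zero , (3 + y) mod m)
  ... | _ , _ , inj₁ (() , _)
  ... | (suc _ , _) , _ , inj₂ (_ , () , _)
  ... | (zero , j) , j∈D , inj₂ (_ , _ , edge) with edge⇒step edge
  ... | _ , off , eq = neighbour off (trans (sym (toℕ-fromℕ< _)) eq)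
    where
    a = occupied (leftIndices D)
    hit : ∀ x → x % m ≡ toℕ j % m → T (a x)
    hit x eq = occupied-by j x (∈-leftIndices j∈D) (trans eq (m<n⇒m%n≡m (toℕ<n j)))
    neighbour : ∀ {d} → Offset d → (3 + y) % m ≡ (toℕ j + d) % m →
                RuleA (a y) (a (1 + y)) (a (2 + y)) (a (3 + y))
    neighbour offset0 eq = inj₂ (inj₂ (hit (3 + y) (trans eq (cong (_% m) (+-identityʳ (toℕ j))))))
    neighbour offset1 eq = inj₂ (inj₁ (hit (2 + y)
      (%-cancelʳ-+ m (2 + y) (toℕ j) 1 (trans (cong (_% m) (+-comm (2 + y) 1)) eq))))
    neighbour offset3 eq = inj₁ (hit y
      (%-cancelʳ-+ m y (toℕ j) 3 (trans (cong (_% m) (+-comm y 3)) eq)))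

  -- Each left vertex (1,y) has a right neighbour in D among (2,y), (2,1+y), (2,3+y).
  right-rule : ∀ D → IsTotalDominating 3 n D → Obeys RuleB (occupied (rightIndices D))
  right-rule D dom y with dom (zero , y mod m)
  ... | _ , _ , inj₂ (() , _)
  ... | (zero , _) , _ , inj₁ (_ , () , _)
  ... | (suc _ , j) , j∈D , inj₁ (_ , _ , edge) with edge⇒step edge
  ... | d , off , eq = neighbour off (trans eq (reduce d))
    where
    reduce : ∀ d → (toℕ (y mod m) + d) % m ≡ (y + d) % m
    reduce d = trans (cong (λ z → (z + d) % m) (toℕ-fromℕ< (m%n<n y m))) (%-absorbˡ-+ m y d)
    a = occupied (rightIndices D)
    hit : ∀ x → toℕ j ≡ x % m → T (a x)
    hit x eq = occupied-by j x (∈-rightIndices j∈D) (sym eq)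
    neighbour : ∀ {d} → Offset d → toℕ j ≡ (y + d) % m →
                RuleB (a y) (a (1 + y)) (a (2 + y)) (a (3 + y))
    neighbour offset0 eq = inj₁ (hit y (trans eq (cong (_% m) (+-identityʳ y))))
    neighbour offset1 eq = inj₂ (inj₁ (hit (1 + y) (trans eq (cong (_% m) (+-comm y 1)))))
    neighbour offset3 eq = inj₂ (inj₂ (hit (3 + y) (trans eq (cong (_% m) (+-comm y 3)))))

  lower-bound : ∀ D → IsTotalDominating 3 n D → ⌈ m * 2 /5⌉ + ⌈ m * 2 /5⌉ ≤ length D
  lower-bound D dom = subst (⌈ m * 2 /5⌉ + ⌈ m * 2 /5⌉ ≤_) (length-indices D)
    (+-mono-≤ (density-bound potentialA-step (leftIndices D) (left-rule D dom))
              (density-bound potentialB-step (rightIndices D) (right-rule D dom)))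

  reflect-< : ∀ s → pred m ∸ s < m
  reflect-< s = m≤pred[n]⇒suc[m]≤n (m∸n≤m (pred m) s)

  left rightReflected : ℕ → KVertex n
  left s           = zero , s mod m
  rightReflected s = suc zero , (pred m ∸ s) mod m

  fromCover : List ℕ → List (KVertex n)
  fromCover S = map left S ++ map rightReflected S

  fromCover-length : ∀ S → length (fromCover S) ≡ length S + length S
  fromCover-length S = trans (length-++ (map left S))
                             (cong₂ _+_ (length-map left S) (length-map rightReflected S))

  fromCover-unique : ∀ {S} → All (_< m) S → Unique S → Unique (fromCover S)
  fromCover-unique {S} S<m uniqueS =
    Unique.++⁺ (unique-map left left-injective S<m uniqueS)
               (unique-map rightReflected right-injective S<m uniqueS) disjoint
    where
    index : KVertex n → ℕ
    index (_ , j) = toℕ j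
    left-injective : ∀ {x y} → x < m → y < m → left x ≡ left y → x ≡ y
    left-injective x<m y<m eq = trans (sym (toℕ-mod x<m)) (trans (cong index eq) (toℕ-mod y<m))
    right-injective : ∀ {x y} → x < m → y < m → rightReflected x ≡ rightReflected y → x ≡ y
    right-injective {x} {y} x<m y<m eq = ∸-cancelˡ-≡ (<⇒≤pred x<m) (<⇒≤pred y<m)
      (trans (sym (toℕ-mod (reflect-< x))) (trans (cong index eq) (toℕ-mod (reflect-< y))))
    disjoint : ∀ {v} → ¬ (v ∈ map left S × v ∈ map rightReflected S)
    disjoint (v∈L , v∈R) with ∈-map⁻ left v∈L | ∈-map⁻ rightReflected v∈R
    ... | _ , _ , refl | _ , _ , ()

  -- If S + {0,1,3} covers {0,…,m−1}, the candidate set is totally dominating: (2,s+d) is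
  -- dominated by (1,s), and (1,x) by (2,m−1−s) where m−1−x = s + d.
  fromCover-dominating : ∀ S → (∀ {x} → x < m → Covered S x) → IsTotalDominating 3 n (fromCover S)
  fromCover-dominating S covers (zero , x) with covers (reflect-< (toℕ x))
  ... | s , s∈S , d , off , eq = rightReflected s , ∈-++⁺ʳ (map left S) (∈-map⁺ rightReflected s∈S) ,
                                 inj₁ (refl , refl , step⇒edge (d , off , reflected))
    where
    reflected : toℕ ((pred m ∸ s) mod m) ≡ (toℕ x + d) % m
    reflected = trans (toℕ-fromℕ< _) (cong (_% m) (∸-reflect (<⇒≤pred (toℕ<n x)) eq))
  fromCover-dominating S covers (suc zero , x) with covers (toℕ<n x)
  ... | s , s∈S , d , off , eq = left s , ∈-++⁺ˡ (∈-map⁺ left s∈S) ,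
                                 inj₂ (refl , refl , step⇒edge (d , off , shifted))
    where
    open ≡-Reasoning
    shifted : toℕ x ≡ (toℕ (s mod m) + d) % m
    shifted = begin
      toℕ x                  ≡⟨ m<n⇒m%n≡m (toℕ<n x) ⟨
      toℕ x % m              ≡⟨ cong (_% m) eq ⟩
      (s + d) % m            ≡⟨ %-absorbˡ-+ m s d ⟨
      (s % m + d) % m        ≡⟨ cong (λ z → (z + d) % m) (toℕ-fromℕ< _) ⟨
      (toℕ (s mod m) + d) % m ∎

  γt : TotalDominationNumber 3 n (⌈ m * 2 /5⌉ + ⌈ m * 2 /5⌉)
  γt = (fromCover (cover m) ,
        fromCover-unique (cover-bound m) (cover-unique m) ,
        fromCover-dominating (cover m) (cover-covers m) ,
        trans (fromCover-length (cover m)) (cong₂ _+_ (cover-length m) (cover-length m)))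
     , λ D _ dom → lower-bound D dom

-- The closed formula

correction-periodic : ∀ n → correction (10 + n) ≡ correction n
correction-periodic n rewrite %-remove-+ˡ n {10} (divides 1 refl) = refl

knodel-formula : ∀ n → n % 2 ≡ 0 → 4 * ceil10 n ≡ correction n + (⌈ n /5⌉ + ⌈ n /5⌉)
knodel-formula 0 _ = refl
knodel-formula 1 ()
knodel-formula 2 _ = refl
knodel-formula 3 ()
knodel-formula 4 _ = refl
knodel-formula 5 ()
knodel-formula 6 _ = refl
knodel-formula 7 ()
knodel-formula 8 _ = refl
knodel-formula 9 ()
knodel-formula (suc (suc (suc (suc (suc (suc (suc (suc (suc (suc n)))))))))) even = begin
  4 * ceil10 (10 + n)                                      ≡⟨ cong (4 *_) ceil10-step ⟩
  4 * (1 + ceil10 n)                                       ≡⟨ *-distribˡ-+ 4 1 (ceil10 n) ⟩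
  4 + 4 * ceil10 n                                         ≡⟨ cong (4 +_) (knodel-formula n even′) ⟩
  4 + (correction n + (⌈ n /5⌉ + ⌈ n /5⌉))                 ≡⟨ regroup (correction n) ⌈ n /5⌉ ⟩
  correction n + ((2 + ⌈ n /5⌉) + (2 + ⌈ n /5⌉))           ≡⟨ cong₂ (λ c t → c + (t + t)) (correction-periodic n) ceil5-step ⟨
  correction (10 + n) + (⌈ 10 + n /5⌉ + ⌈ 10 + n /5⌉)      ∎
  where
  open ≡-Reasoning
  even′ : n % 2 ≡ 0
  even′ = trans (sym (%-remove-+ˡ n {2} (divides 5 refl))) even
  ceil10-step : ceil10 (10 + n) ≡ 1 + ceil10 n
  ceil10-step = +-distrib-/-∣ˡ (n + 9) {10} (divides 1 refl)
  ceil5-step : ⌈ 10 + n /5⌉ ≡ 2 + ⌈ n /5⌉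
  ceil5-step = +-distrib-/-∣ˡ (n + 4) {5} (divides 2 refl)
  regroup : ∀ c t → 4 + (c + (t + t)) ≡ c + ((2 + t) + (2 + t))
  regroup = solve-∀

-- γ_t(W_{3,n}) = 4⌈n/10⌉ − c(n): combine W3.γt (which only needs n/2 ≥ 1) with
-- n/2 · 2 = n and knodel-formula.
theorem3p1 : (n : ℕ) → n % 2 ≡ 0 → 8 ≤ n →
    TotalDominationNumber 3 n (4 * ceil10 n ∸ correction n)
theorem3p1 n even 8≤n = subst (TotalDominationNumber 3 n) size (W3.γt n)
  where
  open ≡-Reasoning
  instance
    half-nonZero : NonZero (n / 2)
    half-nonZero = >-nonZero (≤-trans (s≤s z≤n) (/-monoˡ-≤ 2 8≤n))
  size : ⌈ n / 2 * 2 /5⌉ + ⌈ n / 2 * 2 /5⌉ ≡ 4 * ceil10 n ∸ correction n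
  size = begin
    ⌈ n / 2 * 2 /5⌉ + ⌈ n / 2 * 2 /5⌉                   ≡⟨ cong (λ x → ⌈ x /5⌉ + ⌈ x /5⌉) (m/n*n≡m (m%n≡0⇒n∣m n 2 even)) ⟩
    ⌈ n /5⌉ + ⌈ n /5⌉                                   ≡⟨ m+n∸m≡n (correction n) _ ⟨
    correction n + (⌈ n /5⌉ + ⌈ n /5⌉) ∸ correction n   ≡⟨ cong (_∸ correction n) (knodel-formula n even) ⟨
    4 * ceil10 n ∸ correction n                         ∎
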